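{- Let $(\mathfrak{h},[\cdot,\cdot],*)$ be a graded right Post-Lie algebra with $\mathfrak{h}_0=(0)$. Then for all $(n,m,k)\in\mathbb{N}^3$, $\mathcal{U}(\mathfrak{h})^{\le k}_n*\mathcal{U}(\mathfrak{h})_m\subseteq\mathcal{U}(\mathfrak{h})^{\le k}_{n+m}$, where $*$ is the canonical extension of $*$ to $\mathcal{U}(\mathfrak{h})$ described in the context.
   Context: A right Post-Lie algebra is a Lie algebra with bilinear $*$ satisfying $x*[y,z]=a(x,y,z)-a(x,z,y)$ and $[x,y]*z=[x*z,y]+[x,y*z]$, where $a(x,y,z)=(x*y)*z-x*(y*z)$. Graded: $\mathfrak{h}=\bigoplus_{n\ge0}\mathfrak{h}_n$, $\mathfrak{h}_n$ finite-dimensional, $[\mathfrak{h}_i,\mathfrak{h}_j]\subseteq\mathfrak{h}_{i+j}$, $\mathfrak{h}_i*\mathfrak{h}_j\subseteq\mathfrak{h}_{i+j}$. $\mathcal{U}(\mathfrak{h})=T(\mathfrak{h})/\langle xy-yx-[x,y]\rangle$ inherits the grading where a word of homogeneous letters has degree the sum of the degrees; $\mathcal{U}(\mathfrak{h})_n$ is its degree-$n$ component. $\mathcal{U}(\mathfrak{h})^{\le k}$ is the span of all products $x_1\cdots x_j$ with $j\le k$, $x_i\in\mathfrak{h}$ (with $\mathcal{U}(\mathfrak{h})^{\le0}=\mathbb{K}1$), and $\mathcal{U}(\mathfrak{h})^{\le k}_n=\mathcal{U}(\mathfrak{h})^{\le k}\cap\mathcal{U}(\mathfrak{h})_n$. Canonical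 extension: $*$ extends uniquely to $\mathcal{U}(\mathfrak{h})$ (usual coproduct, Sweedler $\Delta(h)=h^{(1)}\otimes h^{(2)}$) so that for all $f,g,h\in\mathcal{U}(\mathfrak{h})$, $y\in\mathfrak{h}$: $\varepsilon(f*g)=\varepsilon(f)\varepsilon(g)$; $\Delta(f*g)=\Delta(f)*\Delta(g)$; $f*1=f$; $1*f=\varepsilon(f)1$; $f*(gy)=(f*g)*y-f*(g*y)$; $(fg)*h=(f*h^{(1)})(g*h^{(2)})$; $(f*g)*h=f*((g*h^{(1)})h^{(2)})$. -}

module Defs where

open import Level using (Level; _⊔_) renaming (suc to lsuc)
open import Algebra.Bundles using (CommutativeRing)
open import Algebra.Module.Bundles using (Module)
open import Data.Nat using (ℕ; zero; suc; _+_; _≤_)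
open import Data.Fin using (Fin; toℕ) renaming (zero to fz; suc to fs)
open import Data.List using (List; []; _∷_; length; foldr; map)
open import Data.List.Relation.Unary.All using (All)
open import Data.Product using (Σ; ∃; _×_; _,_; proj₁; proj₂)
open import Relation.Nullary using (¬_)
open import Relation.Binary.PropositionalEquality using (_≡_)

record IsField {c ℓ} (K : CommutativeRing c ℓ) : Set (c ⊔ ℓ) where
  open CommutativeRing K
  field
    1≉0 : ¬ (1# ≈ 0#)
    inverse : ∀ x → ¬ (x ≈ 0#) → ∃ λ y → x * y ≈ 1#

-- Everything below is relative to a base commutative ring K and a
-- K-module M (the underlying vector space of 𝔥).

module Over {c ℓ m ℓm} (K : CommutativeRing c ℓ) (M : Module K m ℓm) where
  open CommutativeRing K renaming (Carrier to 𝕂; _+_ to _+ₖ_; _*_ to _*ₖ_; -_ to -ₖ_)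
  open Module M

  sumFin : (N : ℕ) → (Fin N → Carrierᴹ) → Carrierᴹ
  sumFin zero    f = 0ᴹ
  sumFin (suc N) f = f fz +ᴹ sumFin N (λ i → f (fs i))

  _-ᴹ_ : Carrierᴹ → Carrierᴹ → Carrierᴹ
  x -ᴹ y = x +ᴹ (-ᴹ y)

  record IsLieBracket (br : Carrierᴹ → Carrierᴹ → Carrierᴹ) : Set (c ⊔ m ⊔ ℓm) where
    field
      br-cong   : ∀ {x x' y y'} → x ≈ᴹ x' → y ≈ᴹ y' → br x y ≈ᴹ br x' y'
      br-+ˡ     : ∀ x y z → br (x +ᴹ y) z ≈ᴹ br x z +ᴹ br y z
      br-+ʳ     : ∀ x y z → br x (y +ᴹ z) ≈ᴹ br x y +ᴹ br x z
      br-*ˡ     : ∀ (a : 𝕂) x y → br (a *ₗ x) y ≈ᴹ a *ₗ br x y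
      br-*ʳ     : ∀ (a : 𝕂) x y → br x (a *ₗ y) ≈ᴹ a *ₗ br x y
      br-alt    : ∀ x → br x x ≈ᴹ 0ᴹ
      br-jacobi : ∀ x y z →
        (br x (br y z) +ᴹ br y (br z x)) +ᴹ br z (br x y) ≈ᴹ 0ᴹ

  -- A graded right Post-Lie algebra structure on M.
  -- Hom n x  means  x ∈ 𝔥_n.
  record GradedRightPostLie (p : Level) : Set (c ⊔ ℓ ⊔ m ⊔ ℓm ⊔ lsuc p) where
    field
      [_,_] : Carrierᴹ → Carrierᴹ → Carrierᴹ
      _⋆_   : Carrierᴹ → Carrierᴹ → Carrierᴹ
      Hom   : ℕ → Carrierᴹ → Set p
      isLie : IsLieBracket [_,_]
      ⋆-cong : ∀ {x x' y y'} → x ≈ᴹ x' → y ≈ᴹ y' → (x ⋆ y) ≈ᴹ (x' ⋆ y')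
      ⋆-+ˡ   : ∀ x y z → ((x +ᴹ y) ⋆ z) ≈ᴹ (x ⋆ z) +ᴹ (y ⋆ z)
      ⋆-+ʳ   : ∀ x y z → (x ⋆ (y +ᴹ z)) ≈ᴹ (x ⋆ y) +ᴹ (x ⋆ z)
      ⋆-*ˡ   : ∀ (a : 𝕂) x y → ((a *ₗ x) ⋆ y) ≈ᴹ a *ₗ (x ⋆ y)
      ⋆-*ʳ   : ∀ (a : 𝕂) x y → (x ⋆ (a *ₗ y)) ≈ᴹ a *ₗ (x ⋆ y)
    assoc : Carrierᴹ → Carrierᴹ → Carrierᴹ → Carrierᴹ
    assoc x y z = ((x ⋆ y) ⋆ z) -ᴹ (x ⋆ (y ⋆ z))
    field
      postLie₁ : ∀ x y z → (x ⋆ [ y , z ]) ≈ᴹ assoc x y z -ᴹ assoc x z y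
      postLie₂ : ∀ x y z → ([ x , y ] ⋆ z) ≈ᴹ [ x ⋆ z , y ] +ᴹ [ x , y ⋆ z ]
      Hom-cong : ∀ {n x y} → x ≈ᴹ y → Hom n x → Hom n y
      Hom-0    : ∀ n → Hom n 0ᴹ
      Hom-+    : ∀ {n x y} → Hom n x → Hom n y → Hom n (x +ᴹ y)
      Hom-*    : ∀ {n x} (a : 𝕂) → Hom n x → Hom n (a *ₗ x)
      -- 𝔥 = ⊕_{n ≥ 0} 𝔥_n : every element is a finite sum of homogeneous
      -- components, and homogeneous components are independent
      decomp   : ∀ x → Σ ℕ λ N → Σ (Fin N → Carrierᴹ) λ y →
                   (∀ i → Hom (toℕ i) (y i)) × (x ≈ᴹ sumFin N y)
      indep    : ∀ N (y : Fin N → Carrierᴹ) → (∀ i → Hom (toℕ i) (y i)) →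
                   sumFin N y ≈ᴹ 0ᴹ → ∀ i → y i ≈ᴹ 0ᴹ
      finDim   : ∀ n → Σ ℕ λ d → Σ (Fin d → Carrierᴹ) λ b →
                   (∀ i → Hom n (b i)) ×
                   (∀ x → Hom n x → Σ (Fin d → 𝕂) λ a →
                      x ≈ᴹ sumFin d (λ i → a i *ₗ b i))
      Hom-br   : ∀ {i j x y} → Hom i x → Hom j y → Hom (i + j) [ x , y ]
      Hom-⋆    : ∀ {i j x y} → Hom i x → Hom j y → Hom (i + j) (x ⋆ y)

  -- The universal enveloping algebra U(𝔥) = T(𝔥)/⟨xy - yx - [x,y]⟩,
  -- presented as the free unital associative K-algebra on the module M
  -- (terms up to the algebra laws and linearity of the generators)
  -- modulo xy - yx = [x,y].  Elements are terms, equality is _≈U_.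

  module Envelope (br : Carrierᴹ → Carrierᴹ → Carrierᴹ) where

    infixl 6 _⊕_
    infixl 7 _⊙_
    data U : Set (c ⊔ m) where
      ι    : Carrierᴹ → U
      𝟙    : U
      𝟘    : U
      _⊕_  : U → U → U
      _·_  : 𝕂 → U → U
      _⊙_  : U → U → U

    _⊖_ : U → U → U
    f ⊖ g = f ⊕ ((-ₖ 1#) · g)

    infix 4 _≈U_
    data _≈U_ : U → U → Set (c ⊔ ℓ ⊔ m ⊔ ℓm) where
      reflU  : ∀ {f} → f ≈U f
      symU   : ∀ {f g} → f ≈U g → g ≈U f
      transU : ∀ {f g h} → f ≈U g → g ≈U h → f ≈U h
      ⊕-cong : ∀ {f f' g g'} → f ≈U f' → g ≈U g' → f ⊕ g ≈U f' ⊕ g'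
      ⊙-cong : ∀ {f f' g g'} → f ≈U f' → g ≈U g' → f ⊙ g ≈U f' ⊙ g'
      ·-cong : ∀ {a a' f f'} → a ≈ a' → f ≈U f' → a · f ≈U a' · f'
      ⊕-assoc : ∀ f g h → (f ⊕ g) ⊕ h ≈U f ⊕ (g ⊕ h)
      ⊕-comm  : ∀ f g → f ⊕ g ≈U g ⊕ f
      ⊕-idˡ   : ∀ f → 𝟘 ⊕ f ≈U f
      ·-distˡ : ∀ a f g → a · (f ⊕ g) ≈U (a · f) ⊕ (a · g)
      ·-distʳ : ∀ a b f → (a +ₖ b) · f ≈U (a · f) ⊕ (b · f)
      ·-assoc : ∀ a b f → (a *ₖ b) · f ≈U a · (b · f)
      ·-one   : ∀ f → 1# · f ≈U f
      ·-zero  : ∀ f → 0# · f ≈U 𝟘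
      ⊙-assoc : ∀ f g h → (f ⊙ g) ⊙ h ≈U f ⊙ (g ⊙ h)
      ⊙-idˡ   : ∀ f → 𝟙 ⊙ f ≈U f
      ⊙-idʳ   : ∀ f → f ⊙ 𝟙 ≈U f
      ⊙-distˡ : ∀ f g h → f ⊙ (g ⊕ h) ≈U (f ⊙ g) ⊕ (f ⊙ h)
      ⊙-distʳ : ∀ f g h → (f ⊕ g) ⊙ h ≈U (f ⊙ h) ⊕ (g ⊙ h)
      ⊙-·ˡ    : ∀ a f g → (a · f) ⊙ g ≈U a · (f ⊙ g)
      ⊙-·ʳ    : ∀ a f g → f ⊙ (a · g) ≈U a · (f ⊙ g)
      ι-cong  : ∀ {x y} → x ≈ᴹ y → ι x ≈U ι y
      ι-+     : ∀ x y → ι (x +ᴹ y) ≈U ι x ⊕ ι y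
      ι-*     : ∀ a x → ι (a *ₗ x) ≈U a · ι x
      ι-br    : ∀ x y → (ι x ⊙ ι y) ⊖ (ι y ⊙ ι x) ≈U ι (br x y)

    -- U(𝔥) ⊗ U(𝔥): formal combinations of pure tensors modulo
    -- bilinearity and _≈U_ in each factor
    infixl 6 _⊕ₜ_
    data T : Set (c ⊔ m) where
      _⊗_  : U → U → T
      𝟘ₜ   : T
      _⊕ₜ_ : T → T → T
      _·ₜ_ : 𝕂 → T → T

    infix 4 _≈T_
    data _≈T_ : T → T → Set (c ⊔ ℓ ⊔ m ⊔ ℓm) where
      reflT  : ∀ {s} → s ≈T s
      symT   : ∀ {s t} → s ≈T t → t ≈T s
      transT : ∀ {s t r} → s ≈T t → t ≈T r → s ≈T r
      ⊕ₜ-cong : ∀ {s s' t t'} → s ≈T s' → t ≈T t' → s ⊕ₜ t ≈T s' ⊕ₜ t'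
      ·ₜ-cong : ∀ {a a' s s'} → a ≈ a' → s ≈T s' → a ·ₜ s ≈T a' ·ₜ s'
      ⊗-cong  : ∀ {f f' g g'} → f ≈U f' → g ≈U g' → f ⊗ g ≈T f' ⊗ g'
      ⊕ₜ-assoc : ∀ s t r → (s ⊕ₜ t) ⊕ₜ r ≈T s ⊕ₜ (t ⊕ₜ r)
      ⊕ₜ-comm  : ∀ s t → s ⊕ₜ t ≈T t ⊕ₜ s
      ⊕ₜ-idˡ   : ∀ s → 𝟘ₜ ⊕ₜ s ≈T s
      ·ₜ-distˡ : ∀ a s t → a ·ₜ (s ⊕ₜ t) ≈T (a ·ₜ s) ⊕ₜ (a ·ₜ t)
      ·ₜ-distʳ : ∀ a b s → (a +ₖ b) ·ₜ s ≈T (a ·ₜ s) ⊕ₜ (b ·ₜ s)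
      ·ₜ-assoc : ∀ a b s → (a *ₖ b) ·ₜ s ≈T a ·ₜ (b ·ₜ s)
      ·ₜ-one   : ∀ s → 1# ·ₜ s ≈T s
      ·ₜ-zero  : ∀ s → 0# ·ₜ s ≈T 𝟘ₜ
      ⊗-⊕ˡ : ∀ f f' g → (f ⊕ f') ⊗ g ≈T (f ⊗ g) ⊕ₜ (f' ⊗ g)
      ⊗-⊕ʳ : ∀ f g g' → f ⊗ (g ⊕ g') ≈T (f ⊗ g) ⊕ₜ (f ⊗ g')
      ⊗-·ˡ : ∀ a f g → (a · f) ⊗ g ≈T a ·ₜ (f ⊗ g)
      ⊗-·ʳ : ∀ a f g → f ⊗ (a · g) ≈T a ·ₜ (f ⊗ g)

    foldT : ∀ {a} {A : Set a} → (U → U → A) → (A → A → A) → (𝕂 → A → A) → A →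
            T → A
    foldT F add sc z (f ⊗ g)  = F f g
    foldT F add sc z 𝟘ₜ       = z
    foldT F add sc z (s ⊕ₜ t) = add (foldT F add sc z s) (foldT F add sc z t)
    foldT F add sc z (a ·ₜ s) = sc a (foldT F add sc z s)

    -- Sweedler: for a bilinear F, Σ F(h⁽¹⁾, h⁽²⁾) for a tensor Σ h⁽¹⁾ ⊗ h⁽²⁾
    sweedler : (U → U → U) → T → U
    sweedler F = foldT F _⊕_ _·_ 𝟘

    liftT : (U → U → U) → T → T → T
    liftT op s t =
      foldT (λ f g → foldT (λ f' g' → op f f' ⊗ op g g') _⊕ₜ_ _·ₜ_ 𝟘ₜ t)
            _⊕ₜ_ _·ₜ_ 𝟘ₜ s

    Δ : U → T
    Δ (ι x)   = (ι x ⊗ 𝟙) ⊕ₜ (𝟙 ⊗ ι x)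
    Δ 𝟙       = 𝟙 ⊗ 𝟙
    Δ 𝟘       = 𝟘ₜ
    Δ (f ⊕ g) = Δ f ⊕ₜ Δ g
    Δ (a · f) = a ·ₜ Δ f
    Δ (f ⊙ g) = liftT _⊙_ (Δ f) (Δ g)

    ε : U → 𝕂
    ε (ι x)   = 0#
    ε 𝟙       = 1#
    ε 𝟘       = 0#
    ε (f ⊕ g) = ε f +ₖ ε g
    ε (a · f) = a *ₖ ε f
    ε (f ⊙ g) = ε f *ₖ ε g

    -- A (the) canonical extension of ⋆ from 𝔥 to U(𝔥): a bilinear operation
    -- on U(𝔥) restricting to ⋆ on 𝔥 and satisfying the listed identities.
    record CanonicalExtension (⋆𝔥 : Carrierᴹ → Carrierᴹ → Carrierᴹ)
           : Set (c ⊔ ℓ ⊔ m ⊔ ℓm) where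
      field
        _⋆U_ : U → U → U
        ⋆U-cong : ∀ {f f' g g'} → f ≈U f' → g ≈U g' → f ⋆U g ≈U f' ⋆U g'
        ⋆U-⊕ˡ : ∀ f g h → (f ⊕ g) ⋆U h ≈U (f ⋆U h) ⊕ (g ⋆U h)
        ⋆U-⊕ʳ : ∀ f g h → f ⋆U (g ⊕ h) ≈U (f ⋆U g) ⊕ (f ⋆U h)
        ⋆U-·ˡ : ∀ a f g → (a · f) ⋆U g ≈U a · (f ⋆U g)
        ⋆U-·ʳ : ∀ a f g → f ⋆U (a · g) ≈U a · (f ⋆U g)
        extends : ∀ x y → ι x ⋆U ι y ≈U ι (⋆𝔥 x y)
        ext-ε   : ∀ f g → ε (f ⋆U g) ≈ ε f *ₖ ε g
        ext-Δ   : ∀ f g → Δ (f ⋆U g) ≈T liftT _⋆U_ (Δ f) (Δ g)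
        ext-1ʳ  : ∀ f → f ⋆U 𝟙 ≈U f
        ext-1ˡ  : ∀ f → 𝟙 ⋆U f ≈U ε f · 𝟙
        ext-gy  : ∀ f g y →
                  f ⋆U (g ⊙ ι y) ≈U ((f ⋆U g) ⋆U ι y) ⊖ (f ⋆U (g ⋆U ι y))
        ext-fg  : ∀ f g h →
                  (f ⊙ g) ⋆U h ≈U sweedler (λ h₁ h₂ → (f ⋆U h₁) ⊙ (g ⋆U h₂)) (Δ h)
        ext-as  : ∀ f g h →
                  (f ⋆U g) ⋆U h ≈U f ⋆U sweedler (λ h₁ h₂ → (g ⋆U h₁) ⊙ h₂) (Δ h)

    word : List Carrierᴹ → U
    word = foldr (λ x w → ι x ⊙ w) 𝟙

    lincomb : List (𝕂 × List Carrierᴹ) → U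
    lincomb = foldr (λ cw r → (proj₁ cw · word (proj₂ cw)) ⊕ r) 𝟘

    InU≤ : ℕ → U → Set (c ⊔ ℓ ⊔ m ⊔ ℓm)
    InU≤ k f = Σ (List (𝕂 × List Carrierᴹ)) λ L →
                 All (λ cw → length (proj₂ cw) ≤ k) L × (f ≈U lincomb L)

    module Graded {p} (Hom : ℕ → Carrierᴹ → Set p) where
      HLetter : Set (m ⊔ p)
      HLetter = Σ ℕ λ d → Σ Carrierᴹ (Hom d)

      degree : List HLetter → ℕ
      degree = foldr (λ l r → proj₁ l + r) 0

      letters : List HLetter → List Carrierᴹ
      letters = map (λ l → proj₁ (proj₂ l))

      InUdeg : ℕ → U → Set (c ⊔ ℓ ⊔ m ⊔ ℓm ⊔ p)
      InUdeg n f = Σ (List (𝕂 × List HLetter)) λ L →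
                     All (λ cw → degree (proj₂ cw) ≡ n) L ×
                     (f ≈U lincomb (map (λ cw → proj₁ cw , letters (proj₂ cw)) L))

      InU≤deg : ℕ → ℕ → U → Set (c ⊔ ℓ ⊔ m ⊔ ℓm ⊔ p)
      InU≤deg k n f = InU≤ k f × InUdeg n f

{-# OPTIONS --safe #-}

-- For a primitive y the identities of the canonical extension give the Leibniz rule
-- (x w) ⋆ y = (x ⋆ y) w + x (w ⋆ y) and the recursion f ⋆ (g y) = (f ⋆ g) ⋆ y − f ⋆ (g ⋆ y).
-- By induction, first on the left word and then on the length of the right one, the
-- product of a word of length j and degree n with a word of degree m is therefore a
-- combination of words of length exactly j and degree n + m; since 𝔥 is closed under ⋆
-- and ⋆ adds degrees, every letter produced is again a homogeneous element of 𝔥.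

module Submission where

open import Defs
open import Level using (Level; _⊔_)
open import Algebra.Bundles using (CommutativeRing)
open import Algebra.Module.Bundles using (Module)
open import Data.Nat using (ℕ; zero; suc; _+_; _≤_)
open import Data.Nat.Properties
  using (+-assoc; +-comm; +-identityʳ; suc-injective; 0≢1+n; +-commutativeSemigroup)
open import Algebra.Properties.CommutativeSemigroup +-commutativeSemigroup using (xy∙z≈xz∙y)
open import Data.List using (List; []; _∷_; _++_; _∷ʳ_; length; map; foldr)
open import Data.List.Properties using (map-++; map-id; map-cong; length-++)
open import Data.List.Reverse using (Reverse; []; _∶_∶ʳ_; reverseView)
open import Data.List.Relation.Unary.All using (All; []; _∷_)
open import Data.List.Relation.Unary.All.Properties using (++⁺; map⁺)
open import Data.Product using (Σ; _×_; _,_; proj₁; proj₂; map₁)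
open import Data.Unit using (⊤; tt)
open import Data.Empty using (⊥-elim)
open import Relation.Binary.PropositionalEquality
  using (_≡_; refl; sym; trans; cong; cong₂; subst)
open import Relation.Binary.Bundles using (Setoid)
import Relation.Binary.Reasoning.Setoid as SetoidReasoning

module EnvelopeSpans {c ℓ m ℓm} (K : CommutativeRing c ℓ) (M : Module K m ℓm)
  (br : Module.Carrierᴹ M → Module.Carrierᴹ M → Module.Carrierᴹ M) where

  open CommutativeRing K using (0#; 1#; zeroʳ) renaming (Carrier to 𝕂; _*_ to _*ₖ_; refl to ≈-refl)
  open Module M using (Carrierᴹ)
  open Over K M
  open Envelope br

  U-setoid : Setoid (c ⊔ m) (c ⊔ ℓ ⊔ m ⊔ ℓm)
  U-setoid = record
    { Carrier = U ; _≈_ = _≈U_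
    ; isEquivalence = record { refl = reflU ; sym = symU ; trans = transU } }

  open SetoidReasoning U-setoid

  ≡⇒≈U : ∀ {f g} → f ≡ g → f ≈U g
  ≡⇒≈U refl = reflU

  ·-𝟘 : ∀ a → a · 𝟘 ≈U 𝟘
  ·-𝟘 a = begin
    a · 𝟘         ≈⟨ ·-cong ≈-refl (symU (·-zero 𝟘)) ⟩
    a · (0# · 𝟘)  ≈⟨ symU (·-assoc a 0# 𝟘) ⟩
    (a *ₖ 0#) · 𝟘 ≈⟨ ·-cong (zeroʳ a) reflU ⟩
    0# · 𝟘        ≈⟨ ·-zero 𝟘 ⟩
    𝟘             ∎

  word-++ : ∀ xs ys → word (xs ++ ys) ≈U word xs ⊙ word ys
  word-++ []       ys = symU (⊙-idˡ (word ys))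
  word-++ (x ∷ xs) ys = transU (⊙-cong reflU (word-++ xs ys)) (symU (⊙-assoc (ι x) _ _))

  data Span {q} (S : U → Set q) : U → Set (c ⊔ ℓ ⊔ m ⊔ ℓm ⊔ q) where
    span-𝟘 : Span S 𝟘
    span-∈ : ∀ {f} → S f → Span S f
    span-⊕ : ∀ {f g} → Span S f → Span S g → Span S (f ⊕ g)
    span-· : ∀ {f} a → Span S f → Span S (a · f)
    span-≈ : ∀ {f g} → f ≈U g → Span S f → Span S g

  Span-mono : ∀ {q r} {S : U → Set q} {T : U → Set r} →
              (∀ {f} → S f → T f) → ∀ {f} → Span S f → Span T f
  Span-mono S⊆T span-𝟘         = span-𝟘
  Span-mono S⊆T (span-∈ s)     = span-∈ (S⊆T s)
  Span-mono S⊆T (span-⊕ sf sg) = span-⊕ (Span-mono S⊆T sf) (Span-mono S⊆T sg)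
  Span-mono S⊆T (span-· a sf)  = span-· a (Span-mono S⊆T sf)
  Span-mono S⊆T (span-≈ e sf)  = span-≈ e (Span-mono S⊆T sf)

  record Linear (F : U → U) : Set (c ⊔ ℓ ⊔ m ⊔ ℓm) where
    field
      F-cong : ∀ {f g} → f ≈U g → F f ≈U F g
      F-⊕    : ∀ f g → F (f ⊕ g) ≈U F f ⊕ F g
      F-·    : ∀ a f → F (a · f) ≈U a · F f

    F-𝟘 : F 𝟘 ≈U 𝟘
    F-𝟘 = transU (F-cong (symU (·-zero 𝟘))) (transU (F-· 0# 𝟘) (·-zero (F 𝟘)))

  ⊙-linearˡ : ∀ g → Linear (_⊙ g)
  ⊙-linearˡ g = record
    { F-cong = λ e → ⊙-cong e reflU ; F-⊕ = λ f f' → ⊙-distʳ f f' g ; F-· = λ a f → ⊙-·ˡ a f g }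

  ⊙-linearʳ : ∀ f → Linear (f ⊙_)
  ⊙-linearʳ f = record { F-cong = ⊙-cong reflU ; F-⊕ = ⊙-distˡ f ; F-· = λ a g → ⊙-·ʳ a f g }

  module _ {F : U → U} (lin : Linear F) where
    open Linear lin

    Span-image : ∀ {q r} {S : U → Set q} {T : U → Set r} →
                 (∀ {f} → S f → Span T (F f)) → ∀ {f} → Span S f → Span T (F f)
    Span-image FS⊆T span-𝟘         = span-≈ (symU F-𝟘) span-𝟘
    Span-image FS⊆T (span-∈ s)     = FS⊆T s
    Span-image FS⊆T (span-⊕ sf sg) =
      span-≈ (symU (F-⊕ _ _)) (span-⊕ (Span-image FS⊆T sf) (Span-image FS⊆T sg))
    Span-image FS⊆T (span-· a sf)  = span-≈ (symU (F-· a _)) (span-· a (Span-image FS⊆T sf))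
    Span-image FS⊆T (span-≈ e sf)  = span-≈ (F-cong e) (Span-image FS⊆T sf)

  module Extension {⋆𝔥 : Carrierᴹ → Carrierᴹ → Carrierᴹ} (E : CanonicalExtension ⋆𝔥) where

    open CanonicalExtension E
    open Module M using (_≈ᴹ_; ≈ᴹ-refl; ≈ᴹ-sym)
    open CommutativeRing K using () renaming (-_ to -ₖ_)

    ⋆U-linearˡ : ∀ g → Linear (_⋆U g)
    ⋆U-linearˡ g = record
      { F-cong = λ e → ⋆U-cong e reflU ; F-⊕ = λ f f' → ⋆U-⊕ˡ f f' g ; F-· = λ a f → ⋆U-·ˡ a f g }

    ⋆U-linearʳ : ∀ f → Linear (f ⋆U_)
    ⋆U-linearʳ f = record
      { F-cong = ⋆U-cong reflU ; F-⊕ = ⋆U-⊕ʳ f ; F-· = λ a g → ⋆U-·ʳ a f g }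

    𝟙-⋆U-ι : ∀ y → 𝟙 ⋆U ι y ≈U 𝟘
    𝟙-⋆U-ι y = transU (ext-1ˡ (ι y)) (·-zero 𝟙)

    ι⊙-⋆U-ι : ∀ x f y → (ι x ⊙ f) ⋆U ι y ≈U (ι (⋆𝔥 x y) ⊙ f) ⊕ (ι x ⊙ (f ⋆U ι y))
    ι⊙-⋆U-ι x f y = begin
      (ι x ⊙ f) ⋆U ι y
        ≈⟨ ext-fg (ι x) f (ι y) ⟩
      ((ι x ⋆U ι y) ⊙ (f ⋆U 𝟙)) ⊕ ((ι x ⋆U 𝟙) ⊙ (f ⋆U ι y))
        ≈⟨ ⊕-cong (⊙-cong (extends x y) (ext-1ʳ f)) (⊙-cong (ext-1ʳ (ι x)) reflU) ⟩
      (ι (⋆𝔥 x y) ⊙ f) ⊕ (ι x ⊙ (f ⋆U ι y)) ∎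

    module Words {a} {A : Set a} (el : A → Carrierᴹ) (wt : A → ℕ) (_▹_ : A → A → A)
      (el-▹ : ∀ x y → el (x ▹ y) ≈ᴹ ⋆𝔥 (el x) (el y))
      (wt-▹ : ∀ x y → wt (x ▹ y) ≡ wt x + wt y) where

      weight : List A → ℕ
      weight = foldr (λ x w → wt x + w) 0

      wd : List A → U
      wd as = word (map el as)

      WordsWith : ∀ {q} → (List A → Set q) → U → Set (a ⊔ q ⊔ c ⊔ ℓ ⊔ m ⊔ ℓm)
      WordsWith Q u = Σ (List A) λ as → Q as × u ≈U wd as

      Shape : ℕ → ℕ → List A → Set
      Shape n l as = weight as ≡ n × length as ≡ l

      Shaped : ℕ → ℕ → U → Set (a ⊔ c ⊔ ℓ ⊔ m ⊔ ℓm)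
      Shaped n l = WordsWith (Shape n l)

      reweigh : ∀ {n n' l u} → n ≡ n' → Span (Shaped n l) u → Span (Shaped n' l) u
      reweigh {l = l} {u} = subst (λ n → Span (Shaped n l) u)

      weight-∷ʳ : ∀ as y → weight (as ∷ʳ y) ≡ weight as + wt y
      weight-∷ʳ []       y = +-identityʳ (wt y)
      weight-∷ʳ (x ∷ as) y =
        trans (cong (wt x +_) (weight-∷ʳ as y)) (sym (+-assoc (wt x) (weight as) (wt y)))

      length-∷ʳ : ∀ (as : List A) y → length (as ∷ʳ y) ≡ suc (length as)
      length-∷ʳ as y = trans (length-++ as) (+-comm (length as) 1)

      wd-++ : ∀ as bs → wd (as ++ bs) ≈U wd as ⊙ wd bs
      wd-++ as bs = transU (≡⇒≈U (cong word (map-++ el as bs))) (word-++ (map el as) (map el bs))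

      wd-∷ʳ : ∀ as y → wd (as ∷ʳ y) ≈U wd as ⊙ ι (el y)
      wd-∷ʳ as y = transU (wd-++ as (y ∷ [])) (⊙-cong reflU (⊙-idʳ (ι (el y))))

      Span-image-words : ∀ {q r} {Q : List A → Set q} {T : U → Set r} {F : U → U} → Linear F →
                         (∀ {as} → Q as → Span T (F (wd as))) →
                         ∀ {u} → Span (WordsWith Q) u → Span T (F u)
      Span-image-words lin FQ⊆T =
        Span-image lin (λ (as , q , e) → span-≈ (Linear.F-cong lin (symU e)) (FQ⊆T q))

      Span-⊙ : ∀ {f g} → Span (WordsWith (λ _ → ⊤)) f → Span (WordsWith (λ _ → ⊤)) g →
               Span (WordsWith (λ _ → ⊤)) (f ⊙ g)
      Span-⊙ {g = g} sf sg =
        Span-image-words (⊙-linearˡ g) (λ {as} _ →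
          Span-image-words (⊙-linearʳ (wd as)) (λ {bs} _ →
            span-∈ (as ++ bs , tt , symU (wd-++ as bs)))
            sg)
          sf

      Span-cons : ∀ {n l u} x → Span (Shaped n l) u →
                  Span (Shaped (wt x + n) (suc l)) (ι (el x) ⊙ u)
      Span-cons x = Span-image-words (⊙-linearʳ (ι (el x)))
        (λ { {bs} (refl , refl) → span-∈ (x ∷ bs , (refl , refl) , reflU) })

      wd-⋆U-letter : ∀ {n l} as y → Shape n l as →
                     Span (Shaped (n + wt y) l) (wd as ⋆U ι (el y))
      wd-⋆U-letter []       y (refl , refl) = span-≈ (symU (𝟙-⋆U-ι (el y))) span-𝟘
      wd-⋆U-letter (x ∷ as) y (refl , refl) =
        span-≈ (symU expand)
          (span-⊕ (span-∈ ((x ▹ y) ∷ as , (▹-weight , refl) , reflU))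
                  (reweigh (sym (+-assoc (wt x) (weight as) (wt y)))
                    (Span-cons x (wd-⋆U-letter as y (refl , refl)))))
        where
        expand : wd (x ∷ as) ⋆U ι (el y) ≈U wd ((x ▹ y) ∷ as) ⊕ (ι (el x) ⊙ (wd as ⋆U ι (el y)))
        expand = transU (ι⊙-⋆U-ι (el x) (wd as) (el y))
                        (⊕-cong (⊙-cong (ι-cong (≈ᴹ-sym (el-▹ x y))) reflU) reflU)
        ▹-weight : wt (x ▹ y) + weight as ≡ (wt x + weight as) + wt y
        ▹-weight = trans (cong (_+ weight as) (wt-▹ x y)) (xy∙z≈xz∙y (wt x) (wt y) (weight as))

      -- The recursion is on the length k of the right word: the factor wd ws ⋆U ι y is
      -- expanded into words of the same length as ws, not into subterms of it.
      wd-⋆U-wd : ∀ k {n l m} as {ws} → Reverse ws → Shape n l as → Shape m k ws →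
                 Span (Shaped (n + m) l) (wd as ⋆U wd ws)
      wd-⋆U-wd k {n} as [] (w , len) (refl , _) =
        span-≈ (symU (ext-1ʳ (wd as))) (span-∈ (as , (trans w (sym (+-identityʳ n)) , len) , reflU))
      wd-⋆U-wd zero    as (ws ∶ _ ∶ʳ y) sa (_ , len) =
        ⊥-elim (0≢1+n (trans (sym len) (length-∷ʳ ws y)))
      wd-⋆U-wd (suc k) {n} {l} as (ws ∶ _ ∶ʳ y) sa (refl , len) =
        span-≈ (symU expand) (span-⊕ left (span-· (-ₖ 1#) right))
        where
        expand : wd as ⋆U wd (ws ∷ʳ y) ≈U
                 ((wd as ⋆U wd ws) ⋆U ι (el y)) ⊖ (wd as ⋆U (wd ws ⋆U ι (el y)))
        expand = transU (⋆U-cong reflU (wd-∷ʳ ws y)) (ext-gy (wd as) (wd ws) (el y))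
        ws-length : length ws ≡ k
        ws-length = suc-injective (trans (sym (length-∷ʳ ws y)) len)
        left : Span (Shaped (n + weight (ws ∷ʳ y)) l) ((wd as ⋆U wd ws) ⋆U ι (el y))
        left = reweigh (trans (+-assoc n (weight ws) (wt y)) (cong (n +_) (sym (weight-∷ʳ ws y))))
          (Span-image-words (⋆U-linearˡ (ι (el y))) (λ {bs} sb → wd-⋆U-letter bs y sb)
            (wd-⋆U-wd k as (reverseView ws) sa (refl , ws-length)))
        right : Span (Shaped (n + weight (ws ∷ʳ y)) l) (wd as ⋆U (wd ws ⋆U ι (el y)))
        right = reweigh (cong (n +_) (sym (weight-∷ʳ ws y)))
          (Span-image-words (⋆U-linearʳ (wd as))
            (λ {vs} (w , lv) → wd-⋆U-wd k as (reverseView vs) sa (w , trans lv ws-length))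
            (wd-⋆U-letter ws y (refl , refl)))

      ⋆U-WordsWith : ∀ {q r s} {Qf : List A → Set q} {Qg : List A → Set r} {Q : List A → Set s} →
                     (∀ {as ws bs} → Qf as → Qg ws →
                        Shape (weight as + weight ws) (length as) bs → Q bs) →
                     ∀ {f g} → Span (WordsWith Qf) f → Span (WordsWith Qg) g →
                     Span (WordsWith Q) (f ⋆U g)
      ⋆U-WordsWith shape⇒Q {g = g} sf sg =
        Span-image-words (⋆U-linearˡ g) (λ {as} qa →
          Span-image-words (⋆U-linearʳ (wd as)) (λ {ws} qw →
            Span-mono (λ (bs , sb , e) → bs , shape⇒Q qa qw sb , e)
              (wd-⋆U-wd _ as (reverseView ws) (refl , refl) (refl , refl)))
            sg)
          sf

      lincombʷ : List (𝕂 × List A) → U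
      lincombʷ L = lincomb (map (λ cw → proj₁ cw , map el (proj₂ cw)) L)

      lincombʷ-++ : ∀ L L' → lincombʷ (L ++ L') ≈U lincombʷ L ⊕ lincombʷ L'
      lincombʷ-++ []       L' = symU (⊕-idˡ _)
      lincombʷ-++ (_ ∷ L)  L' = transU (⊕-cong reflU (lincombʷ-++ L L')) (symU (⊕-assoc _ _ _))

      lincombʷ-· : ∀ a L → lincombʷ (map (map₁ (a *ₖ_)) L) ≈U a · lincombʷ L
      lincombʷ-· a []      = symU (·-𝟘 a)
      lincombʷ-· a (_ ∷ L) = transU (⊕-cong (·-assoc a _ _) (lincombʷ-· a L)) (symU (·-distˡ a _ _))

      lincombʷ∈Span : ∀ {q} {Q : List A → Set q} L → All (λ cw → Q (proj₂ cw)) L →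
                      Span (WordsWith Q) (lincombʷ L)
      lincombʷ∈Span []             []       = span-𝟘
      lincombʷ∈Span ((k , as) ∷ L) (q ∷ qs) =
        span-⊕ (span-· k (span-∈ (as , q , reflU))) (lincombʷ∈Span L qs)

      Span⇒lincombʷ : ∀ {q} {Q : List A → Set q} {u} → Span (WordsWith Q) u →
                      Σ (List (𝕂 × List A)) λ L → All (λ cw → Q (proj₂ cw)) L × u ≈U lincombʷ L
      Span⇒lincombʷ span-𝟘                = [] , [] , reflU
      Span⇒lincombʷ (span-∈ (as , q , e)) =
        (1# , as) ∷ [] , q ∷ [] , transU e (symU (transU (⊕-comm _ 𝟘) (transU (⊕-idˡ _) (·-one _))))
      Span⇒lincombʷ (span-⊕ sf sg) with Span⇒lincombʷ sf | Span⇒lincombʷ sg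
      ... | L , qs , e | L' , qs' , e' =
        L ++ L' , ++⁺ qs qs' , transU (⊕-cong e e') (symU (lincombʷ-++ L L'))
      Span⇒lincombʷ (span-· a sf) with Span⇒lincombʷ sf
      ... | L , qs , e =
        map (map₁ (a *ₖ_)) L , map⁺ qs , transU (·-cong ≈-refl e) (symU (lincombʷ-· a L))
      Span⇒lincombʷ (span-≈ e sf) with Span⇒lincombʷ sf
      ... | L , qs , e' = L , qs , transU (symU e) e'

    module Plain = Words (λ x → x) (λ _ → 0) ⋆𝔥 (λ _ _ → ≈ᴹ-refl) (λ _ _ → refl)

    Plain-lincombʷ : ∀ L → Plain.lincombʷ L ≡ lincomb L
    Plain-lincombʷ L =
      cong lincomb (trans (map-cong (λ (k , xs) → cong (k ,_) (map-id xs)) L) (map-id L))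

    Plain-spans : ∀ u → Span (Plain.WordsWith (λ _ → ⊤)) u
    Plain-spans (ι x)   = span-∈ (x ∷ [] , tt , symU (⊙-idʳ (ι x)))
    Plain-spans 𝟙       = span-∈ ([] , tt , reflU)
    Plain-spans 𝟘       = span-𝟘
    Plain-spans (f ⊕ g) = span-⊕ (Plain-spans f) (Plain-spans g)
    Plain-spans (a · f) = span-· a (Plain-spans f)
    Plain-spans (f ⊙ g) = Plain.Span-⊙ (Plain-spans f) (Plain-spans g)

    InU≤⇒Span : ∀ {k f} → InU≤ k f → Span (Plain.WordsWith (λ xs → length xs ≤ k)) f
    InU≤⇒Span (L , lens , e) =
      span-≈ (symU (transU e (≡⇒≈U (sym (Plain-lincombʷ L))))) (Plain.lincombʷ∈Span L lens)

    Span⇒InU≤ : ∀ {k f} → Span (Plain.WordsWith (λ xs → length xs ≤ k)) f → InU≤ k f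
    Span⇒InU≤ s =
      let (L , lens , e) = Plain.Span⇒lincombʷ s in L , lens , transU e (≡⇒≈U (Plain-lincombʷ L))

    ⋆U-InU≤ : ∀ {k f} g → InU≤ k f → InU≤ k (f ⋆U g)
    ⋆U-InU≤ {k} g f≤ = Span⇒InU≤
      (Plain.⋆U-WordsWith (λ lena _ (_ , len) → subst (_≤ k) (sym len) lena)
        (InU≤⇒Span f≤) (Plain-spans g))

module GradedPostLie {c ℓ m ℓm p} (K : CommutativeRing c ℓ) (M : Module K m ℓm)
  (P : Over.GradedRightPostLie K M p)
  (E : Over.Envelope.CanonicalExtension K M
         (Over.GradedRightPostLie.[_,_] P) (Over.GradedRightPostLie._⋆_ P)) where

  open Module M using (≈ᴹ-refl)
  open Over K M
  open GradedRightPostLie P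
  open Envelope [_,_]
  open Graded Hom
  open EnvelopeSpans K M [_,_]
  open CanonicalExtension E using (_⋆U_)
  open Extension E

  _▹_ : HLetter → HLetter → HLetter
  (d , x , hx) ▹ (e , y , hy) = d + e , x ⋆ y , Hom-⋆ hx hy

  -- With these letters, weight is literally degree and lincombʷ is the combination in InUdeg.
  open Words (λ l → proj₁ (proj₂ l)) proj₁ _▹_ (λ _ _ → ≈ᴹ-refl) (λ _ _ → refl)

  ⋆U-InUdeg : ∀ {n m' f g} → InUdeg n f → InUdeg m' g → InUdeg (n + m') (f ⋆U g)
  ⋆U-InUdeg (Lf , degf , ef) (Lg , degg , eg) =
    Span⇒lincombʷ (⋆U-WordsWith (λ dega degw (w , _) → trans w (cong₂ _+_ dega degw))
      (span-≈ (symU ef) (lincombʷ∈Span Lf degf))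
      (span-≈ (symU eg) (lincombʷ∈Span Lg degg)))

mainTheorem13 : ∀ {c ℓ m ℓm p : Level}
    (K : CommutativeRing c ℓ) → IsField K →
    (M : Module K m ℓm) →
    (P : Over.GradedRightPostLie K M p) →
    -- 𝔥₀ = (0)
    (∀ x → Over.GradedRightPostLie.Hom P 0 x →
       Module._≈ᴹ_ M x (Module.0ᴹ M)) →
    (E : Over.Envelope.CanonicalExtension K M
           (Over.GradedRightPostLie.[_,_] P) (Over.GradedRightPostLie._⋆_ P)) →
    ∀ (n m' k : ℕ) (f g : Over.Envelope.U K M (Over.GradedRightPostLie.[_,_] P)) →
    Over.Envelope.Graded.InU≤deg K M (Over.GradedRightPostLie.[_,_] P)
      (Over.GradedRightPostLie.Hom P) k n f →
    Over.Envelope.Graded.InUdeg K M (Over.GradedRightPostLie.[_,_] P)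
      (Over.GradedRightPostLie.Hom P) m' g →
    Over.Envelope.Graded.InU≤deg K M (Over.GradedRightPostLie.[_,_] P)
      (Over.GradedRightPostLie.Hom P) k (n + m')
      (Over.Envelope.CanonicalExtension._⋆U_ E f g)
mainTheorem13 K _ M P _ E n m' k f g (f≤ , fd) gd = ⋆U-InU≤ g f≤ , ⋆U-InUdeg fd gd
  where
  open EnvelopeSpans.Extension K M _ E using (⋆U-InU≤)
  open GradedPostLie K M P E using (⋆U-InUdeg)
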